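{- Let $k\ge2$, $2\le i\le k$ and $n\ge2$ be integers. For $\lambda\in\{1,2\}$ and $m\ge1$ let $B_{k,m}=(b_{st})$ be the $m\times m$ matrix with $b_{s,s+1}=-1$, $b_{st}=1$ if $1\le s-t\le k-1$, $b_{ss}=\lambda$, $b_{st}=0$ otherwise, and let $B_{k,n}^{i}$ be the $n\times n$ matrix whose first row is $(1,-1,0,\dots,0)$, whose first column has entry $1$ in rows $1,\dots,\min(n,k-i+1)$ and $0$ in the remaining rows, and whose submatrix obtained by deleting the first row and column is $B_{k,n-1}$. Then $\det(B_{k,n}^{i})=f_{k,n}^{i}$ when $\lambda=1$, and $\det(B_{k,n}^{i})=p_{k,n}^{i}$ when $\lambda=2$, where $f$ and $p$ are as in the context.
   Context: For a positive integer $k$ and $1\le i\le k$, the sequences $(f_{k,n}^{i})_{n\ge1-k}$ (generalized order-$k$ Fibonacci) and $(p_{k,n}^{i})_{n\ge1-k}$ (generalized order-$k$ Pell) have initial values equal to $1$ if $i=1-n$ and $0$ otherwise, for $1-k\le n\le 0$, and satisfy for $n\ge1$ the recurrences $f_{k,n}^{i}=f_{k,n-1}^{i}+f_{k,n-2}^{i}+\cdots+f_{k,n-k}^{i}$ and $p_{k,n}^{i}=2p_{k,n-1}^{i}+p_{k,n-2}^{i}+\cdots+p_{k,n-k}^{i}$. -}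

module Defs where

open import Data.Nat using (ℕ; zero; suc; _+_; _*_; _∸_; _≤ᵇ_; _<ᵇ_; _≡ᵇ_)
open import Data.Integer using (ℤ; +_; -_) renaming (_+_ to _+ℤ_; _*_ to _*ℤ_)
open import Data.Fin using (Fin; zero; suc; toℕ; punchIn)
open import Data.List using (List; []; _∷_; take)
open import Data.Nat.ListAction using (sum)
open import Data.Bool using (Bool; true; false; if_then_else_)

Matrix : ℕ → Set
Matrix n = Fin n → Fin n → ℤ

Σᶠ : (n : ℕ) → (Fin n → ℤ) → ℤ
Σᶠ zero    g = + 0
Σᶠ (suc n) g = g zero +ℤ Σᶠ n (λ j → g (suc j))

sign : ℕ → ℤ
sign zero    = + 1
sign (suc j) = - sign j

minor : ∀ {n} → Matrix (suc n) → Fin (suc n) → Matrix n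
minor M j r c = M (suc r) (punchIn j c)

det : (n : ℕ) → Matrix n → ℤ
det zero    M = + 1
det (suc n) M = Σᶠ (suc n) (λ j → sign (toℕ j) *ℤ (M zero j *ℤ det n (minor M j)))

-- Generalized order-k sequences a_n = λ a_{n-1} + a_{n-2} + ... + a_{n-k},
-- with initial values a^i_n = [i = 1 - n] for 1-k ≤ n ≤ 0.
-- Internally we use the shifted index m = n + k - 1 (so m ≥ 0 ⟺ n ≥ 1-k).
-- history λ k i m = [a_m , a_{m-1} , ... , a_0]  (shifted indices)

nextTerm : ℕ → ℕ → ℕ → ℕ → List ℕ → ℕ
nextTerm λ' k i m' h with m' <ᵇ k | h
... | true  | _      = if (i + m' ≡ᵇ k) then 1 else 0
... | false | []     = 0
... | false | x ∷ xs = λ' * x + sum (take (k ∸ 1) xs)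

history : ℕ → ℕ → ℕ → ℕ → List ℕ
history λ' k i zero    = nextTerm λ' k i 0 [] ∷ []
history λ' k i (suc m) = nextTerm λ' k i (suc m) (history λ' k i m) ∷ history λ' k i m

headOr0 : List ℕ → ℕ
headOr0 []      = 0
headOr0 (x ∷ _) = x

-- genSeq λ k i n = a^i_{k,n} for n ≥ 0 (paper index n, natural numbers only)
genSeq : ℕ → ℕ → ℕ → ℕ → ℕ
genSeq λ' k i n = headOr0 (history λ' k i (n + (k ∸ 1)))

fib : ℕ → ℕ → ℕ → ℕ
fib = genSeq 1

pell : ℕ → ℕ → ℕ → ℕ
pell = genSeq 2

-- The matrices.  Indices are 0-based (Fin), the paper's are 1-based;
-- differences s - t are unaffected.

Bmat : ℕ → ℕ → (m : ℕ) → Matrix m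
Bmat λ' k m s t =
  if toℕ t ≡ᵇ suc (toℕ s) then - (+ 1)
  else if toℕ s ≡ᵇ toℕ t then + λ'
  else if (suc (toℕ t) ≤ᵇ toℕ s) Data.Bool.∧ (toℕ s ≤ᵇ toℕ t + (k ∸ 1)) then + 1
  else + 0

Bimat : ℕ → ℕ → ℕ → (n : ℕ) → Matrix n
Bimat λ' k i zero    ()
Bimat λ' k i (suc n) zero zero             = + 1
Bimat λ' k i (suc n) zero (suc zero)       = - (+ 1)
Bimat λ' k i (suc n) zero (suc (suc _))    = + 0
-- row (toℕ r + 2) in 1-based indexing; entry 1 iff that row ≤ min(n, k-i+1)
-- (the bound by n is automatic)
Bimat λ' k i (suc n) (suc r) zero          =
  if toℕ r + 2 ≤ᵇ (k ∸ i) + 1 then + 1 else + 0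
Bimat λ' k i (suc n) (suc r) (suc c)       = Bmat λ' k n r c

-- Expanding along the first row, a matrix with first row (v₀, -1, 0, …), first column v and
-- B_{k,m} in the lower right corner has determinant v₀ det B_{k,m} plus the determinant of the
-- matrix of the same shape, one size smaller, with first column v shifted up by one (B_{k,m}
-- is Toeplitz).  B_{k,m+1} and B^i_{k,m+1} have this shape; writing D_m = det B_{k,m} and E^i_m
-- for the determinant of size m+1 with first column c_i = ([i + r ≤ k])_r, this gives
--   D_{m+2} = λ D_{m+1} + E^2_m   and   E^i_{m+1} = [i ≤ k] D_{m+1} + E^{i+1}_m.
-- The sequences satisfy the same system a^1_{n+1} = λ a^1_n + a^2_n and
-- a^i_{n+1} = [i ≤ k] a^1_n + a^{i+1}_n (i ≥ 2), because both sides of each identity solve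
-- the order-k recurrence and agree on its k initial values; induction on n concludes.
module Submission where

open import Defs
open import Data.Bool using (Bool; true; false; if_then_else_)
open import Data.Fin using (Fin; zero; suc; toℕ; punchIn)
open import Data.Integer using (ℤ; +_; -_) renaming (_+_ to _+ℤ_; _*_ to _*ℤ_)
import Data.Integer.Properties as ℤ
open import Data.List using (_∷_; take; drop)
open import Data.Nat using (ℕ; zero; suc; _+_; _*_; _∸_; _≤_; _<_; _≡ᵇ_; _≤ᵇ_; s≤s)
open import Data.Nat.Induction using (<-rec)
open import Data.Nat.ListAction using (sum)
open import Data.Nat.Properties
open import Data.Nat.Solver using (module +-*-Solver)
open import Data.Product using (_×_; _,_)
open import Function using (_∘_; _⇔_; mk⇔)
open import Relation.Binary.PropositionalEquality
open import Relation.Nullary using (yes; no)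
open import Relation.Nullary.Decidable using (dec-true; dec-false; does-⇔)

indicator : Bool → ℕ
indicator b = if b then 1 else 0

indicator-≡ᵇ-≡ : ∀ {a b} → a ≡ b → indicator (a ≡ᵇ b) ≡ 1
indicator-≡ᵇ-≡ {a} {b} a≡b = cong indicator (dec-true (a ≟ b) a≡b)

indicator-≡ᵇ-≢ : ∀ {a b} → a ≢ b → indicator (a ≡ᵇ b) ≡ 0
indicator-≡ᵇ-≢ {a} {b} a≢b = cong indicator (dec-false (a ≟ b) a≢b)

window : (ℕ → ℕ) → ℕ → ℕ → ℕ
window f b zero    = 0
window f b (suc c) = f (b + c) + window f b c

window-cong : ∀ {f g b b′} c → (∀ j → j < c → f (b + j) ≡ g (b′ + j)) →
              window f b c ≡ window g b′ c
window-cong zero    eq = refl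
window-cong (suc c) eq = cong₂ _+_ (eq c ≤-refl) (window-cong c (λ j j<c → eq j (m<n⇒m<1+n j<c)))

window-linear : ∀ p f g b c →
                window (λ m → p * f m + g m) b c ≡ p * window f b c + window g b c
window-linear p f g b zero    = sym (trans (+-identityʳ (p * 0)) (*-zeroʳ p))
window-linear p f g b (suc c) = begin
  p * f (b + c) + g (b + c) + window (λ m → p * f m + g m) b c
    ≡⟨ cong (λ w → p * f (b + c) + g (b + c) + w) (window-linear p f g b c) ⟩
  p * f (b + c) + g (b + c) + (p * window f b c + window g b c)
    ≡⟨ solve 5 (λ p x y u v → p :* x :+ y :+ (p :* u :+ v) := p :* (x :+ u) :+ (y :+ v))
             refl p (f (b + c)) (g (b + c)) (window f b c) (window g b c) ⟩
  p * (f (b + c) + window f b c) + (g (b + c) + window g b c) ∎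
  where
  open ≡-Reasoning
  open +-*-Solver

window-indicator-below : ∀ k a c → a + c ≤ k → window (λ m → indicator (m ≡ᵇ k)) a c ≡ 0
window-indicator-below k a zero    _     = refl
window-indicator-below k a (suc c) a+c≤k =
  cong₂ _+_ (indicator-≡ᵇ-≢ (<⇒≢ (subst (_≤ k) (+-suc a c) a+c≤k)))
            (window-indicator-below k a c (≤-trans (+-monoʳ-≤ a (n≤1+n c)) a+c≤k))

window-indicator : ∀ k a c → k < a + c → window (λ m → indicator (m ≡ᵇ k)) a c ≡ indicator (a ≤ᵇ k)
window-indicator k a zero    k<a = sym (cong indicator (dec-false (a ≤? k) (<⇒≱ (subst (k <_) (+-identityʳ a) k<a))))
window-indicator k a (suc c) k<a+c with a + c ≟ k
... | yes a+c≡k = begin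
  indicator (a + c ≡ᵇ k) + window (λ m → indicator (m ≡ᵇ k)) a c
    ≡⟨ cong₂ _+_ (indicator-≡ᵇ-≡ a+c≡k) (window-indicator-below k a c (≤-reflexive a+c≡k)) ⟩
  1
    ≡⟨ sym (cong indicator (dec-true (a ≤? k) (subst (a ≤_) a+c≡k (m≤m+n a c)))) ⟩
  indicator (a ≤ᵇ k) ∎
  where open ≡-Reasoning
... | no a+c≢k = cong₂ _+_ (indicator-≡ᵇ-≢ a+c≢k) (window-indicator k a c k<a+c′)
  where
  k<a+c′ : k < a + c
  k<a+c′ = ≤∧≢⇒< (≤-pred (subst (k <_) (+-suc a c) k<a+c)) (a+c≢k ∘ sym)

module Recurrence (l K : ℕ) where

  IsSolution : (ℕ → ℕ) → Set
  IsSolution f = ∀ b → f (b + suc K) ≡ l * f (b + K) + window f b K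

  isSolution-suc : ∀ {f} → IsSolution f → IsSolution (f ∘ suc)
  isSolution-suc {f} sol b =
    trans (sol (suc b)) (cong (λ w → l * f (suc b + K) + w) (window-cong K (λ _ _ → refl)))

  isSolution-linear : ∀ p {f g} → IsSolution f → IsSolution g → IsSolution (λ m → p * f m + g m)
  isSolution-linear p {f} {g} solf solg b = begin
    p * f (b + suc K) + g (b + suc K)
      ≡⟨ cong₂ (λ x y → p * x + y) (solf b) (solg b) ⟩
    p * (l * f (b + K) + window f b K) + (l * g (b + K) + window g b K)
      ≡⟨ solve 6 (λ p l x y u v → p :* (l :* x :+ u) :+ (l :* y :+ v) := l :* (p :* x :+ y) :+ (p :* u :+ v))
               refl p l (f (b + K)) (g (b + K)) (window f b K) (window g b K) ⟩
    l * (p * f (b + K) + g (b + K)) + (p * window f b K + window g b K)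
      ≡⟨ cong (λ w → l * (p * f (b + K) + g (b + K)) + w) (sym (window-linear p f g b K)) ⟩
    l * (p * f (b + K) + g (b + K)) + window (λ m → p * f m + g m) b K ∎
    where
    open ≡-Reasoning
    open +-*-Solver

  solution-unique : ∀ {f g} → IsSolution f → IsSolution g →
                    (∀ m → m < suc K → f m ≡ g m) → ∀ m → f m ≡ g m
  solution-unique {f} {g} solf solg initial = <-rec (λ m → f m ≡ g m) agree
    where
    agree-beyond : ∀ b → (∀ {j} → j < b + suc K → f j ≡ g j) → f (b + suc K) ≡ g (b + suc K)
    agree-beyond b earlier = begin
      f (b + suc K)                 ≡⟨ solf b ⟩
      l * f (b + K) + window f b K  ≡⟨ cong₂ (λ x y → l * x + y) (earlier (+-monoʳ-< b ≤-refl))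
                                              (window-cong K (λ j j<K → earlier (+-monoʳ-< b (m<n⇒m<1+n j<K)))) ⟩
      l * g (b + K) + window g b K  ≡⟨ solg b ⟨
      g (b + suc K)                 ∎
      where open ≡-Reasoning

    agree : ∀ m → (∀ {j} → j < m → f j ≡ g j) → f m ≡ g m
    agree m earlier with m <? suc K
    ... | yes m<k = initial m m<k
    ... | no  m≮k = subst (λ x → f x ≡ g x) m≡b+k
                      (agree-beyond (m ∸ suc K) (λ j<b+k → earlier (subst (_ <_) m≡b+k j<b+k)))
      where
      m≡b+k : m ∸ suc K + suc K ≡ m
      m≡b+k = m∸n+n≡m (≮⇒≥ m≮k)

-- term i m is the paper's a^i_n at the shifted index m = n + k - 1, as in genSeq.
module Sequence (l K : ℕ) where
  open Recurrence l K

  term : ℕ → ℕ → ℕ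
  term i m = headOr0 (history l (suc K) i m)

  nextTerm-initial : ∀ i m h → m < suc K → nextTerm l (suc K) i m h ≡ indicator (i + m ≡ᵇ suc K)
  nextTerm-initial i m h m<k rewrite dec-true (m <? suc K) m<k = refl

  nextTerm-recurrent : ∀ i m x xs → K ≤ m →
                       nextTerm l (suc K) i (suc m) (x ∷ xs) ≡ l * x + sum (take K xs)
  nextTerm-recurrent i m x xs K≤m rewrite dec-false (suc m <? suc K) (≤⇒≯ (s≤s K≤m)) = refl

  history-∷ : ∀ i m → history l (suc K) i m ≡ term i m ∷ drop 1 (history l (suc K) i m)
  history-∷ i zero    = refl
  history-∷ i (suc m) = refl

  sum-take-history : ∀ i b c → sum (take c (drop 1 (history l (suc K) i (b + c)))) ≡ window (term i) b c
  sum-take-history i b zero    = refl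
  sum-take-history i b (suc c) = begin
    sum (take (suc c) (drop 1 (history l (suc K) i (b + suc c))))
      ≡⟨ cong (λ m → sum (take (suc c) (drop 1 (history l (suc K) i m)))) (+-suc b c) ⟩
    sum (take (suc c) (history l (suc K) i (b + c)))
      ≡⟨ cong (sum ∘ take (suc c)) (history-∷ i (b + c)) ⟩
    term i (b + c) + sum (take c (drop 1 (history l (suc K) i (b + c))))
      ≡⟨ cong (λ w → term i (b + c) + w) (sum-take-history i b c) ⟩
    window (term i) b (suc c) ∎
    where open ≡-Reasoning

  term-initial : ∀ i m → m < suc K → term i m ≡ indicator (i + m ≡ᵇ suc K)
  term-initial i zero    _   = refl
  term-initial i (suc m) m<k = nextTerm-initial i (suc m) (history l (suc K) i m) m<k

  term-isSolution : ∀ i → IsSolution (term i)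
  term-isSolution i b = begin
    term i (b + suc K)
      ≡⟨ cong (term i) (+-suc b K) ⟩
    nextTerm l (suc K) i (suc (b + K)) (history l (suc K) i (b + K))
      ≡⟨ cong (nextTerm l (suc K) i (suc (b + K))) (history-∷ i (b + K)) ⟩
    nextTerm l (suc K) i (suc (b + K)) (term i (b + K) ∷ drop 1 (history l (suc K) i (b + K)))
      ≡⟨ nextTerm-recurrent i (b + K) _ _ (m≤n+m K b) ⟩
    l * term i (b + K) + sum (take K (drop 1 (history l (suc K) i (b + K))))
      ≡⟨ cong (λ w → l * term i (b + K) + w) (sum-take-history i b K) ⟩
    l * term i (b + K) + window (term i) b K ∎
    where open ≡-Reasoning

  term-1-K≡1 : term 1 K ≡ 1
  term-1-K≡1 = trans (term-initial 1 K ≤-refl) (indicator-≡ᵇ-≡ {suc K} refl)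

  term-K≡0 : ∀ i → 2 ≤ i → term i K ≡ 0
  term-K≡0 i 2≤i = trans (term-initial i K ≤-refl) (indicator-≡ᵇ-≢ (>⇒≢ (+-monoˡ-≤ K 2≤i)))

  window-term-initial : ∀ i → window (term i) 0 K ≡ window (λ m → indicator (m ≡ᵇ suc K)) i K
  window-term-initial i = window-cong K (λ j j<K → term-initial i j (m<n⇒m<1+n j<K))

  term-at-k : ∀ i → term i (suc K) ≡ l * term i K + window (λ m → indicator (m ≡ᵇ suc K)) i K
  term-at-k i = trans (term-isSolution i 0) (cong (λ w → l * term i K + w) (window-term-initial i))

  term-1-k≡l : term 1 (suc K) ≡ l
  term-1-k≡l = begin
    term 1 (suc K)                                               ≡⟨ term-at-k 1 ⟩
    l * term 1 K + window (λ m → indicator (m ≡ᵇ suc K)) 1 K    ≡⟨ cong₂ (λ x y → l * x + y) term-1-K≡1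
                                                                      (window-indicator-below (suc K) 1 K ≤-refl) ⟩
    l * 1 + 0                                                    ≡⟨ trans (+-identityʳ (l * 1)) (*-identityʳ l) ⟩
    l                                                            ∎
    where open ≡-Reasoning

  term-k≡indicator : ∀ i → 2 ≤ i → term i (suc K) ≡ indicator (i ≤ᵇ suc K)
  term-k≡indicator i 2≤i = begin
    term i (suc K)                                                 ≡⟨ term-at-k i ⟩
    l * term i K + window (λ m → indicator (m ≡ᵇ suc K)) i K      ≡⟨ cong₂ (λ x y → l * x + y) (term-K≡0 i 2≤i)
                                                                        (window-indicator (suc K) i K (+-monoˡ-≤ K 2≤i)) ⟩
    l * 0 + indicator (i ≤ᵇ suc K)                                 ≡⟨ cong (λ x → x + indicator (i ≤ᵇ suc K)) (*-zeroʳ l) ⟩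
    indicator (i ≤ᵇ suc K)                                         ∎
    where open ≡-Reasoning

  -- The coefficient term i (suc K) is the paper's a^i_1; both sides solve the recurrence
  -- and agree on the k initial values.
  term-suc : ∀ i → 1 ≤ i → ∀ m → term i (suc m) ≡ term i (suc K) * term 1 m + term (suc i) m
  term-suc i 1≤i = solution-unique (isSolution-suc (term-isSolution i))
                     (isSolution-linear (term i (suc K)) (term-isSolution 1) (term-isSolution (suc i)))
                     initial
    where
    open ≡-Reasoning
    initial : ∀ m → m < suc K → term i (suc m) ≡ term i (suc K) * term 1 m + term (suc i) m
    initial m m<k with m ≟ K
    ... | yes refl = begin
      term i (suc K)                                ≡⟨ *-identityʳ (term i (suc K)) ⟨
      term i (suc K) * 1                            ≡⟨ +-identityʳ (term i (suc K) * 1) ⟨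
      term i (suc K) * 1 + 0                        ≡⟨ cong₂ (λ x y → term i (suc K) * x + y)
                                                         term-1-K≡1 (term-K≡0 (suc i) (s≤s 1≤i)) ⟨
      term i (suc K) * term 1 K + term (suc i) K    ∎
    ... | no m≢K = begin
      term i (suc m)                                ≡⟨ term-initial i (suc m) sm<k ⟩
      indicator (i + suc m ≡ᵇ suc K)                ≡⟨ cong (λ x → indicator (x ≡ᵇ suc K)) (+-suc i m) ⟩
      indicator (suc i + m ≡ᵇ suc K)                ≡⟨ term-initial (suc i) m m<k ⟨
      term (suc i) m                                ≡⟨ cong (λ x → x + term (suc i) m) coefficient≡0 ⟨
      term i (suc K) * term 1 m + term (suc i) m    ∎
      where
      sm<k : suc m < suc K
      sm<k = s≤s (≤∧≢⇒< (≤-pred m<k) m≢K)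
      coefficient≡0 : term i (suc K) * term 1 m ≡ 0
      coefficient≡0 = trans (cong (term i (suc K) *_)
                                  (trans (term-initial 1 m m<k) (indicator-≡ᵇ-≢ (m≢K ∘ suc-injective))))
                            (*-zeroʳ (term i (suc K)))

  term-1-suc : ∀ m → term 1 (suc m) ≡ l * term 1 m + term 2 m
  term-1-suc m = trans (term-suc 1 ≤-refl m) (cong (λ c → c * term 1 m + term 2 m) term-1-k≡l)

  term-suc-≥2 : ∀ i → 2 ≤ i → ∀ m → term i (suc m) ≡ indicator (i ≤ᵇ suc K) * term 1 m + term (suc i) m
  term-suc-≥2 i 2≤i m =
    trans (term-suc i (<⇒≤ 2≤i) m) (cong (λ c → c * term 1 m + term (suc i) m) (term-k≡indicator i 2≤i))

row-bound⇔ : ∀ {i k} x → i ≤ k → (x + 2 ≤ (k ∸ i) + 1) ⇔ (i + suc x ≤ k)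
row-bound⇔ {i} {k} x i≤k = mk⇔
  (λ le → subst (_≤ k) (+-comm (suc x) i)
            (m≤o∸n⇒m+n≤o (suc x) i≤k (+-cancelʳ-≤ 1 (suc x) (k ∸ i) (subst (_≤ (k ∸ i) + 1) (+-suc x 1) le))))
  (λ le → subst (_≤ (k ∸ i) + 1) (sym (+-suc x 1))
            (+-monoˡ-≤ 1 (m+n≤o⇒m≤o∸n (suc x) (subst (_≤ k) (+-comm i (suc x)) le))))

Σᶠ-cong : ∀ n {f g : Fin n → ℤ} → (∀ j → f j ≡ g j) → Σᶠ n f ≡ Σᶠ n g
Σᶠ-cong zero    eq = refl
Σᶠ-cong (suc n) eq = cong₂ _+ℤ_ (eq zero) (Σᶠ-cong n (eq ∘ suc))

Σᶠ-zero : ∀ n → Σᶠ n (λ _ → + 0) ≡ + 0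
Σᶠ-zero zero    = refl
Σᶠ-zero (suc n) = trans (ℤ.+-identityˡ _) (Σᶠ-zero n)

det-cong : ∀ n {M N : Matrix n} → (∀ r c → M r c ≡ N r c) → det n M ≡ det n N
det-cong zero    eq = refl
det-cong (suc n) eq = Σᶠ-cong (suc n) λ j →
  cong₂ (λ x y → sign (toℕ j) *ℤ (x *ℤ y)) (eq zero j) (det-cong n (λ r c → eq (suc r) (punchIn j c)))

-1*-1*i≡i : ∀ i → - (+ 1) *ℤ (- (+ 1) *ℤ i) ≡ i
-1*-1*i≡i i = trans (ℤ.-1*i≡-i _) (trans (cong -_ (ℤ.-1*i≡-i i)) (ℤ.neg-involutive i))

module Bordered (l K : ℕ) where

  B : (m : ℕ) → Matrix m
  B = Bmat l (suc K)

  bordered : (ℕ → ℤ) → (m : ℕ) → Matrix (suc m)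
  bordered v m zero    zero          = v 0
  bordered v m zero    (suc zero)    = - (+ 1)
  bordered v m zero    (suc (suc _)) = + 0
  bordered v m (suc r) zero          = v (suc (toℕ r))
  bordered v m (suc r) (suc c)       = B m r c

  det-bordered-cong : ∀ {v w} m → (∀ r → v r ≡ w r) → det (suc m) (bordered v m) ≡ det (suc m) (bordered w m)
  det-bordered-cong {v} {w} m eq = det-cong (suc m) pointwise
    where
    pointwise : ∀ r c → bordered v m r c ≡ bordered w m r c
    pointwise zero    zero          = eq 0
    pointwise zero    (suc zero)    = refl
    pointwise zero    (suc (suc c)) = refl
    pointwise (suc r) zero          = eq (suc (toℕ r))
    pointwise (suc r) (suc c)       = refl

  -- Since B is a Toeplitz matrix, deleting the first row and the second column of
  -- bordered v (suc m) leaves bordered (v ∘ suc) m.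
  minor-bordered : ∀ v m r c → minor (bordered v (suc m)) (suc zero) r c ≡ bordered (v ∘ suc) m r c
  minor-bordered v m zero          zero          = refl
  minor-bordered v m zero          (suc zero)    = refl
  minor-bordered v m zero          (suc (suc c)) = refl
  minor-bordered v m (suc r)       zero          = refl
  minor-bordered v m (suc zero)    (suc c)       = refl
  minor-bordered v m (suc (suc r)) (suc c)       = refl

  det-bordered-zero : ∀ v → det 1 (bordered v 0) ≡ v 0
  det-bordered-zero v = trans (ℤ.+-identityʳ _) (trans (ℤ.*-identityˡ _) (ℤ.*-identityʳ (v 0)))

  det-bordered-suc : ∀ v m → det (suc (suc m)) (bordered v (suc m)) ≡
                     v 0 *ℤ det (suc m) (B (suc m)) +ℤ det (suc m) (bordered (v ∘ suc) m)
  det-bordered-suc v m = cong₂ _+ℤ_ (ℤ.*-identityˡ (v 0 *ℤ det (suc m) (B (suc m)))) (begin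
    - (+ 1) *ℤ (- (+ 1) *ℤ det (suc m) (minor (bordered v (suc m)) (suc zero))) +ℤ rest
      ≡⟨ cong₂ _+ℤ_ (-1*-1*i≡i (det (suc m) (minor (bordered v (suc m)) (suc zero)))) rest≡0 ⟩
    det (suc m) (minor (bordered v (suc m)) (suc zero)) +ℤ + 0
      ≡⟨ ℤ.+-identityʳ _ ⟩
    det (suc m) (minor (bordered v (suc m)) (suc zero))
      ≡⟨ det-cong (suc m) (minor-bordered v m) ⟩
    det (suc m) (bordered (v ∘ suc) m) ∎)
    where
    open ≡-Reasoning
    rest : ℤ
    rest = Σᶠ m (λ j → sign (suc (suc (toℕ j))) *ℤ (+ 0 *ℤ det (suc m) (minor (bordered v (suc m)) (suc (suc j)))))
    rest≡0 : rest ≡ + 0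
    rest≡0 = trans (Σᶠ-cong m (λ j → ℤ.*-zeroʳ (sign (suc (suc (toℕ j)))))) (Σᶠ-zero m)

  column : ℕ → ℕ → ℤ
  column i r = if i + r ≤ᵇ suc K then + 1 else + 0

  column-zero : ∀ i → column i 0 ≡ + indicator (i ≤ᵇ suc K)
  column-zero i rewrite +-identityʳ i with i ≤ᵇ suc K
  ... | true  = refl
  ... | false = refl

  column-suc : ∀ i r → column i (suc r) ≡ column (suc i) r
  column-suc i r = cong (λ x → if x ≤ᵇ suc K then + 1 else + 0) (+-suc i r)

  leadColumn : ℕ → ℤ
  leadColumn zero    = + l
  leadColumn (suc r) = column 2 r

  B-suc-bordered : ∀ m r c → B (suc m) r c ≡ bordered leadColumn m r c
  B-suc-bordered m zero          zero          = refl
  B-suc-bordered m zero          (suc zero)    = refl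
  B-suc-bordered m zero          (suc (suc c)) = refl
  B-suc-bordered m (suc r)       zero          = refl
  B-suc-bordered m (suc zero)    (suc c)       = refl
  B-suc-bordered m (suc (suc r)) (suc c)       = refl

  det-B-one : det 1 (B 1) ≡ + l
  det-B-one = trans (det-cong 1 (B-suc-bordered 0)) (det-bordered-zero leadColumn)

  det-B-suc : ∀ m → det (suc (suc m)) (B (suc (suc m))) ≡
              + l *ℤ det (suc m) (B (suc m)) +ℤ det (suc m) (bordered (column 2) m)
  det-B-suc m = trans (det-cong (suc (suc m)) (B-suc-bordered (suc m))) (det-bordered-suc leadColumn m)

  det-column-zero : ∀ i → det 1 (bordered (column i) 0) ≡ + indicator (i ≤ᵇ suc K)
  det-column-zero i = trans (det-bordered-zero (column i)) (column-zero i)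

  det-column-suc : ∀ i m → det (suc (suc m)) (bordered (column i) (suc m)) ≡
                   + indicator (i ≤ᵇ suc K) *ℤ det (suc m) (B (suc m)) +ℤ det (suc m) (bordered (column (suc i)) m)
  det-column-suc i m = trans (det-bordered-suc (column i) m)
    (cong₂ (λ x y → x *ℤ det (suc m) (B (suc m)) +ℤ y) (column-zero i) (det-bordered-cong m (column-suc i)))

  Bimat-bordered : ∀ i n → i ≤ suc K → ∀ r c → Bimat l (suc K) i (suc n) r c ≡ bordered (column i) n r c
  Bimat-bordered i n i≤k zero    zero          = cong (λ b → if b then + 1 else + 0)
    (sym (dec-true (i + 0 ≤? suc K) (subst (_≤ suc K) (sym (+-identityʳ i)) i≤k)))
  Bimat-bordered i n i≤k zero    (suc zero)    = refl
  Bimat-bordered i n i≤k zero    (suc (suc c)) = refl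
  Bimat-bordered i n i≤k (suc r) zero          = cong (λ b → if b then + 1 else + 0)
    (does-⇔ (row-bound⇔ (toℕ r) i≤k) (toℕ r + 2 ≤? (suc K ∸ i) + 1) (i + suc (toℕ r) ≤? suc K))
  Bimat-bordered i n i≤k (suc r) (suc c)       = refl

pos-*-+ : ∀ c {x y} a b → x ≡ + a → y ≡ + b → + c *ℤ x +ℤ y ≡ + (c * a + b)
pos-*-+ c a b refl refl = trans (cong (λ z → z +ℤ + b) (sym (ℤ.pos-* c a))) (sym (ℤ.pos-+ (c * a) b))

module Determinants (l K : ℕ) where
  open Sequence l K
  open Bordered l K

  mutual
    det-B≡term : ∀ n → det (suc n) (B (suc n)) ≡ + term 1 (suc n + K)
    det-B≡term zero    = trans det-B-one (cong +_ (sym term-1-k≡l))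
    det-B≡term (suc n) = begin
      det (suc (suc n)) (B (suc (suc n)))
        ≡⟨ det-B-suc n ⟩
      + l *ℤ det (suc n) (B (suc n)) +ℤ det (suc n) (bordered (column 2) n)
        ≡⟨ pos-*-+ l _ _ (det-B≡term n) (det-column≡term 2 ≤-refl n) ⟩
      + (l * term 1 (suc n + K) + term 2 (suc n + K))
        ≡⟨ cong +_ (term-1-suc (suc n + K)) ⟨
      + term 1 (suc (suc n) + K) ∎
      where open ≡-Reasoning

    det-column≡term : ∀ i → 2 ≤ i → ∀ n → det (suc n) (bordered (column i) n) ≡ + term i (suc n + K)
    det-column≡term i 2≤i zero    = trans (det-column-zero i) (cong +_ (sym (term-k≡indicator i 2≤i)))
    det-column≡term i 2≤i (suc n) = begin
      det (suc (suc n)) (bordered (column i) (suc n))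
        ≡⟨ det-column-suc i n ⟩
      + indicator (i ≤ᵇ suc K) *ℤ det (suc n) (B (suc n)) +ℤ det (suc n) (bordered (column (suc i)) n)
        ≡⟨ pos-*-+ (indicator (i ≤ᵇ suc K)) _ _ (det-B≡term n) (det-column≡term (suc i) (m≤n⇒m≤1+n 2≤i) n) ⟩
      + (indicator (i ≤ᵇ suc K) * term 1 (suc n + K) + term (suc i) (suc n + K))
        ≡⟨ cong +_ (term-suc-≥2 i 2≤i (suc n + K)) ⟨
      + term i (suc (suc n) + K) ∎
      where open ≡-Reasoning

  det-Bimat≡genSeq : ∀ i n → 2 ≤ i → i ≤ suc K → det (suc n) (Bimat l (suc K) i (suc n)) ≡ + genSeq l (suc K) i (suc n)
  det-Bimat≡genSeq i n 2≤i i≤k = trans (det-cong (suc n) (Bimat-bordered i n i≤k)) (det-column≡term i 2≤i n)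

corollary1p14 : (k i n : ℕ) → 2 ≤ k → 2 ≤ i → i ≤ k → 2 ≤ n →
    (det n (Bimat 1 k i n) ≡ + fib k i n) × (det n (Bimat 2 k i n) ≡ + pell k i n)
corollary1p14 (suc K) i (suc n) _ 2≤i i≤k _ =
  Determinants.det-Bimat≡genSeq 1 K i n 2≤i i≤k , Determinants.det-Bimat≡genSeq 2 K i n 2≤i i≤k
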